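{- Let $m\ge 2$ be an integer and $n=2^m$. Then the line graph $L(\overline{\Gamma(\mathbb{Z}_n[i])})$ of the complement of the zero-divisor graph of $\mathbb{Z}_n[i]$ is pancyclic.
   Context: $\mathbb{Z}_n[i]=\mathbb{Z}[i]/\langle n\rangle=\{a+bi : a,b\in\mathbb{Z}_n\}$ with $i^2=-1$. For a finite commutative ring $R$ with unity, $\Gamma(R)$ has vertex set the nonzero zero-divisors of $R$, distinct $x,y$ adjacent iff $xy=0$. $\overline{G}$ is the complement graph of $G$. The line graph $L(G)$ has the edges of $G$ as vertices, two being adjacent iff they share an endpoint in $G$. A graph of order $N$ is pancyclic if $N\ge 3$ and it contains a cycle of length $k$ for every $3\le k\le N$. -}

module Defs where

open import Data.Nat using (ℕ; suc; _+_; _*_; _∸_; _^_; _≤_; _<_; NonZero)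
open import Data.Nat.Properties using (m^n≢0)
open import Data.Nat.DivMod using (_mod_)
open import Data.Fin using (Fin; toℕ; zero; suc)
open import Data.Product using (Σ; ∃; _×_; _,_; proj₁; proj₂)
open import Data.Sum using (_⊎_)
open import Data.List using (List; length)
open import Data.List.Membership.Propositional using (_∈_)
open import Data.List.Relation.Unary.Unique.Propositional using (Unique)
open import Relation.Binary.PropositionalEquality using (_≡_; _≢_)
open import Relation.Nullary using (¬_)
open import Function.Bundles using (_⇔_)

-- The ring Z_n[i] = { a + b i : a, b ∈ Z_n },  i² = -1.
-- An element a + b i is the pair (a , b).

ZnI : ℕ → Set
ZnI n = Fin n × Fin n

module _ (n : ℕ) .{{_ : NonZero n}} where

  0ᵢ : ZnI n
  0ᵢ = 0 mod n , 0 mod n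

  -- (a + b i)(c + d i) = (ac - bd) + (ad + bc) i ;  -bd ≡ (n-1)·bd (mod n)
  mulᵢ : ZnI n → ZnI n → ZnI n
  mulᵢ (a , b) (c , d) =
    ( (toℕ a * toℕ c + (n ∸ 1) * (toℕ b * toℕ d)) mod n
    , (toℕ a * toℕ d + toℕ b * toℕ c) mod n )

  IsNZZeroDivisor : ZnI n → Set
  IsNZZeroDivisor x = x ≢ 0ᵢ × ∃ λ y → y ≢ 0ᵢ × mulᵢ x y ≡ 0ᵢ

-- Simple graphs whose vertex set is a subset of a carrier type C.

record Graph (C : Set) : Set₁ where
  field
    Vertex : C → Set
    Adj    : C → C → Set

open Graph public

Γ : (n : ℕ) .{{_ : NonZero n}} → Graph (ZnI n)
Vertex (Γ n) = IsNZZeroDivisor n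
Adj    (Γ n) x y = x ≢ y × mulᵢ n x y ≡ 0ᵢ n

complement : {C : Set} → Graph C → Graph C
Vertex (complement G) = Vertex G
Adj    (complement G) x y = Vertex G x × Vertex G y × x ≢ y × ¬ Adj G x y

-- Line graph.  A strict total order _<ₒ_ on C is used to represent each
-- (unordered) edge {x , y} uniquely by the pair (x , y) with x <ₒ y.
LineGraph : {C : Set} → (C → C → Set) → Graph C → Graph (C × C)
Vertex (LineGraph _<ₒ_ G) (x , y) = x <ₒ y × Adj G x y
Adj    (LineGraph _<ₒ_ G) e f =
  e ≢ f × (proj₁ e ≡ proj₁ f ⊎ proj₁ e ≡ proj₂ f ⊎ proj₂ e ≡ proj₁ f ⊎ proj₂ e ≡ proj₂ f)

_<ᵢ_ : {n : ℕ} → ZnI n → ZnI n → Set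
_<ᵢ_ {n} (a , b) (c , d) = toℕ a * n + toℕ b < toℕ c * n + toℕ d

HasOrder : {C : Set} → Graph C → ℕ → Set
HasOrder {C} G N = Σ (List C) λ vs →
  Unique vs × length vs ≡ N × (∀ c → (Vertex G c ⇔ c ∈ vs))

next : {k : ℕ} → Fin k → Fin k
next {suc k} i = (toℕ i + 1) mod (suc k)

HasCycle : {C : Set} → Graph C → ℕ → Set
HasCycle {C} G k = Σ (Fin k → C) λ v →
  (∀ i → Vertex G (v i)) ×
  (∀ i j → v i ≡ v j → i ≡ j) ×
  (∀ i → Adj G (v i) (v (next i)))

Pancyclic : {C : Set} → Graph C → Set
Pancyclic G = Σ ℕ λ N → HasOrder G N × 3 ≤ N × (∀ k → 3 ≤ k → k ≤ N → HasCycle G k)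

-- Let n = 2h with h ≥ 2, which covers n = 2^m.  In ℤ_n[i] both 1 + i and 1 - i are
-- annihilated exactly by 0 and z = h + h i.  So in G, the complement of Γ(ℤ_n[i]),
-- the two "hubs" 1 ± i are adjacent to each other and to every vertex except z.
--
-- In any graph with two such hubs u < u' the edges can be listed as x₀ = {u, u'}
-- followed by one block per ordinary vertex a (neither a hub nor z):  {g, a}, the
-- hub-free edges owned by a, {g', a},  where the hubs g, g' alternate from block to
-- block.  Every block is a star through a, consecutive blocks meet in a hub, and the
-- first and last edges of every block meet x₀.  Hence x₀ followed by whole blocks and
-- then part of one more block closes up into a cycle of L(G) of any length from 3 to
-- the number of edges.

module Submission where

open import Defs
open import Data.Nat using (ℕ; zero; suc; _+_; _*_; _∸_; _^_; _≤_; _<_; z≤n; s≤s; _<?_; _≤?_; NonZero)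
open import Data.Nat.Properties
  using (≤-trans; <-irrefl; ≤-antisym; ≤-pred; ≮⇒≥; ≰⇒>; <⇒≤; +-comm; +-suc; +-cancelˡ-≤;
         m≤n⇒m⊓n≡m; m≤n⇒∃[o]m+o≡n; suc-injective; 1+n≢n; ≤-reflexive; +-identityʳ;
         *-comm; *-cancelʳ-≡; +-cancelʳ-≡; <-cmp; m≤n+m; m<m+n; n<1+n; +-mono-≤; +-mono-<; +-monoʳ-≤;
         m≤m+n; m+n≡0⇒m≡0; *-identityˡ; +-monoʳ-<;
         m^n≢0; m^n>0; ∸-monoˡ-≤; m+[n∸m]≡n)
open import Data.Nat.DivMod using (_%_; _mod_; m<n⇒m%n≡m; n%n≡0; [m+kn]%n≡m%n)
open import Data.Fin using (Fin; toℕ; zero; suc)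
import Data.Fin as F
open import Data.Nat.Divisibility using (_∣_; divides; ∣m+n∣m⇒∣n; n∣m*n; m%n≡0⇒n∣m; n∣m⇒m%n≡0)
open import Data.Nat.Tactic.RingSolver using (solve-∀)
open import Data.Fin.Properties using (toℕ-fromℕ<; toℕ-injective; toℕ<n; any?)
open import Data.Product.Properties using (≡-dec)
open import Data.Product using (∃; _×_; _,_; proj₁; proj₂)
open import Data.Sum using (_⊎_; inj₁; inj₂; [_,_]′)
open import Data.Unit using (⊤; tt)
open import Data.Empty using (⊥-elim)
open import Data.List using (List; []; _∷_; _++_; length; lookup; take; filter; cartesianProduct; allFin)
open import Data.List.Properties using (length-++; length-take; ++-assoc)
open import Data.List.Relation.Unary.All as All using (All; []; _∷_)
import Data.List.Relation.Unary.All.Properties as AllP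
open import Data.List.Relation.Unary.Any using (here; there)
open import Data.List.Relation.Binary.Disjoint.Propositional using (Disjoint)
open import Data.List.Relation.Unary.AllPairs using ([]; _∷_)
open import Data.List.Relation.Unary.Unique.Propositional using (Unique)
open import Data.List.Membership.Propositional using (_∈_)
open import Data.List.Membership.Propositional.Properties
  using (∈-lookup; ∈-filter⁺; ∈-filter⁻; ∈-cartesianProduct⁺; ∈-++⁺ʳ; ∈-++⁺ˡ; ∈-++⁻; ∈-allFin)
import Data.List.Relation.Unary.Unique.Propositional.Properties as UP
open import Data.List.Relation.Binary.Sublist.Propositional using (_⊆_; []; _∷_; _∷ʳ_; ⊆-refl)
open import Data.List.Relation.Binary.Sublist.Propositional.Properties
  using (All-resp-⊆; take-⊆; ++⁺; []⊆-universal)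
open import Function.Bundles using (mk⇔)
open import Function using (_∘_)
open import Relation.Binary.PropositionalEquality using (_≡_; _≢_; refl; sym; trans; cong; cong₂; subst)
open Relation.Binary.PropositionalEquality.≡-Reasoning
open import Relation.Nullary using (¬_; Dec; yes; no; ¬?)
open import Relation.Nullary.Decidable using (_×-dec_; _⊎-dec_; map′)
import Relation.Unary as U
open import Relation.Binary.Definitions using (Trichotomous; tri<; tri≈; tri>; DecidableEquality)
open import Relation.Binary.Consequences using (tri⇒dec≈; tri⇒dec<; tri⇒asym; tri⇒irr)

Unique-resp-⊆ : {A : Set} {xs ys : List A} → xs ⊆ ys → Unique ys → Unique xs
Unique-resp-⊆ []          u        = u
Unique-resp-⊆ (y ∷ʳ s)    (_ ∷ u)  = Unique-resp-⊆ s u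
Unique-resp-⊆ (refl ∷ s)  (p ∷ u)  = All-resp-⊆ s p ∷ Unique-resp-⊆ s u

lookup-injective : {A : Set} {xs : List A} → Unique xs → ∀ i j → lookup xs i ≡ lookup xs j → i ≡ j
lookup-injective (p ∷ u) zero    zero    e = refl
lookup-injective (p ∷ u) zero    (suc j) e = ⊥-elim (All.lookup p (∈-lookup j) e)
lookup-injective (p ∷ u) (suc i) zero    e = ⊥-elim (All.lookup p (∈-lookup i) (sym e))
lookup-injective (p ∷ u) (suc i) (suc j) e = cong suc (lookup-injective u i j e)

take-length : {A : Set} (xs : List A) {t : ℕ} → t ≤ length xs → length (take t xs) ≡ t
take-length xs {t} t≤ = trans (length-take t xs) (m≤n⇒m⊓n≡m t≤)

Walk : {D : Set} → (D → D → Set) → D → List D → D → Set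
Walk R a []       b = R a b
Walk R a (x ∷ xs) b = R a x × Walk R x xs b

-- The entry following position i in  a ∷ xs ++ [ b ].
successor : {D : Set} → D → (xs : List D) → D → Fin (suc (length xs)) → D
successor a []       b zero    = b
successor a (x ∷ xs) b zero    = x
successor a (x ∷ xs) b (suc i) = successor x xs b i

module _ {D : Set} {R : D → D → Set} where

  walk-++ : ∀ {a c b} xs {ys} → Walk R a xs c → Walk R c ys b → Walk R a (xs ++ c ∷ ys) b
  walk-++ []       r       w = r , w
  walk-++ (x ∷ xs) (r , v) w = r , walk-++ xs v w

  clique-walk : (Cl : D → Set) → (∀ {y z} → Cl y → Cl z → R y z) →
    ∀ {a b xs} → Cl a → All Cl xs → Cl b → Walk R a xs b
  clique-walk Cl clique ca []          cb = clique ca cb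
  clique-walk Cl clique ca (cx ∷ cxs)  cb = clique ca cx , clique-walk Cl clique cx cxs cb

  walk-successor : ∀ {a b} xs → Walk R a xs b → ∀ i → R (lookup (a ∷ xs) i) (successor a xs b i)
  walk-successor []       r       zero    = r
  walk-successor (x ∷ xs) (r , _) zero    = r
  walk-successor (x ∷ xs) (_ , w) (suc i) = walk-successor xs w i

successor-inner : {D : Set} (a : D) → ∀ xs b (i j : Fin (suc (length xs))) →
  toℕ j ≡ suc (toℕ i) → successor a xs b i ≡ lookup (a ∷ xs) j
successor-inner a []       b zero    zero          ()
successor-inner a (x ∷ xs) b zero    (suc zero)    _ = refl
successor-inner a (x ∷ xs) b (suc i) (suc j)       e = successor-inner x xs b i j (suc-injective e)

successor-last : {D : Set} (a : D) → ∀ xs b (i : Fin (suc (length xs))) →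
  toℕ i ≡ length xs → successor a xs b i ≡ b
successor-last a []       b zero    _ = refl
successor-last a (x ∷ xs) b (suc i) e = successor-last x xs b i (suc-injective e)

next-inner : ∀ {k} (i : Fin (suc k)) → toℕ i < k → toℕ (next i) ≡ suc (toℕ i)
next-inner {k} i i<k = trans (toℕ-fromℕ< _) (trans (m<n⇒m%n≡m (s≤s (subst (_≤ k) (+-comm 1 (toℕ i)) i<k)))
                                                    (+-comm (toℕ i) 1))

next-last : ∀ {k} (i : Fin (suc k)) → toℕ i ≡ k → next i ≡ zero
next-last {k} i i≡k = toℕ-injective (trans (toℕ-fromℕ< _)
  (trans (cong (λ m → (m + 1) % suc k) i≡k) (trans (cong (_% suc k) (+-comm k 1)) (n%n≡0 (suc k)))))

successor-closed : {D : Set} (a : D) → ∀ xs (i : Fin (suc (length xs))) →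
  successor a xs a i ≡ lookup (a ∷ xs) (next i)
successor-closed a xs i with toℕ i <? length xs
... | yes i<k = successor-inner a xs a i (next i) (next-inner i i<k)
... | no  i≮k = trans (successor-last a xs a i last) (cong (lookup (a ∷ xs)) (sym (next-last i last)))
  where
  last : toℕ i ≡ length xs
  last = ≤-antisym (≤-pred (toℕ<n i)) (≮⇒≥ i≮k)

next-moves : ∀ {k} → 1 ≤ k → (i : Fin (suc k)) → next i ≢ i
next-moves {k} 1≤k i e with toℕ i <? k
... | yes i<k = 1+n≢n (trans (sym (next-inner i i<k)) (cong toℕ e))
... | no  i≮k with ≤-antisym (≤-pred (toℕ<n i)) (≮⇒≥ i≮k)
...   | last = <-irrefl (trans (sym (cong toℕ (trans (sym e) (next-last i last)))) last) 1≤k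

closed-walk⇒cycle : {D : Set} (G : Graph D) {R : D → D → Set} →
  (∀ {e f} → e ≢ f → R e f → Adj G e f) →
  ∀ a xs → Walk R a xs a → Unique (a ∷ xs) → All (Vertex G) (a ∷ xs) → 1 ≤ length xs →
  HasCycle G (suc (length xs))
closed-walk⇒cycle G {R} edge a xs w u vs 1≤k =
  lookup (a ∷ xs) , (λ i → All.lookup vs (∈-lookup i)) , lookup-injective u , adjacent
  where
  adjacent : ∀ i → Adj G (lookup (a ∷ xs) i) (lookup (a ∷ xs) (next i))
  adjacent i = edge (λ e → next-moves 1≤k i (sym (lookup-injective u _ _ e)))
                    (subst (R (lookup (a ∷ xs) i)) (successor-closed a xs i) (walk-successor xs w i))

module _ {C : Set} where

  Shares : C × C → C × C → Set
  Shares e f = proj₁ e ≡ proj₁ f ⊎ proj₁ e ≡ proj₂ f ⊎ proj₂ e ≡ proj₁ f ⊎ proj₂ e ≡ proj₂ f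

  _∈ₑ_ : C → C × C → Set
  x ∈ₑ e = proj₁ e ≡ x ⊎ proj₂ e ≡ x

  common-endpoint : ∀ {x e f} → x ∈ₑ e → x ∈ₑ f → Shares e f
  common-endpoint (inj₁ p) (inj₁ q) = inj₁ (trans p (sym q))
  common-endpoint (inj₁ p) (inj₂ q) = inj₂ (inj₁ (trans p (sym q)))
  common-endpoint (inj₂ p) (inj₁ q) = inj₂ (inj₂ (inj₁ (trans p (sym q))))
  common-endpoint (inj₂ p) (inj₂ q) = inj₂ (inj₂ (inj₂ (trans p (sym q))))

  record Block : Set where
    constructor block
    field
      first  : C × C
      middle : List (C × C)
      last   : C × C

  open Block

  infixr 5 _▸_
  _▸_ : Block → List (C × C) → List (C × C)
  block s mid f ▸ rest = s ∷ mid ++ f ∷ rest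

  flatten : List Block → List (C × C)
  flatten []       = []
  flatten (b ∷ bs) = b ▸ flatten bs

  size : Block → ℕ
  size b = suc (suc (length (middle b)))

  length-▸ : ∀ b rest → length (b ▸ rest) ≡ size b + length rest
  length-▸ (block s mid f) rest = cong suc (trans (length-++ mid) (+-suc (length mid) (length rest)))

  ▸-++ : ∀ b rest → b ▸ rest ≡ (b ▸ []) ++ rest
  ▸-++ (block s mid f) rest = cong (s ∷_) (sym (++-assoc mid (f ∷ []) rest))

  ▸-⊆ : ∀ b {P Q} → P ⊆ Q → b ▸ P ⊆ b ▸ Q
  ▸-⊆ (block s mid f) P⊆Q = refl ∷ ++⁺ ⊆-refl (refl ∷ P⊆Q)

  Star : Block → Set
  Star (block s mid f) = ∃ λ a → a ∈ₑ s × All (a ∈ₑ_) mid × a ∈ₑ f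

  Chained : C × C → C × C → List Block → Set
  Chained x₀ prev []       = ⊤
  Chained x₀ prev (b ∷ bs) =
    Shares prev (first b) × Shares (first b) x₀ × Shares (last b) x₀ × Star b × Chained x₀ (last b) bs

  block-walk : ∀ {x₀ prev} b {rest} → Shares prev (first b) → Star b →
    Walk Shares (last b) rest x₀ → Walk Shares prev (b ▸ rest) x₀
  block-walk (block s mid f) p→s (a , as , amid , af) w =
    p→s , walk-++ mid (clique-walk (a ∈ₑ_) common-endpoint as amid af) w

  block-walks : ∀ {x₀ prev} b rest → Shares prev (first b) → Shares (first b) x₀ →
    Shares (last b) x₀ → Star b → ∀ t → 1 ≤ t → t ≤ size b →
    ∃ λ P → P ⊆ b ▸ rest × length P ≡ t × Walk Shares prev P x₀
  block-walks (block s mid f) rest p→s s→x₀ f→x₀ star (suc zero) _ _ =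
    s ∷ [] , refl ∷ []⊆-universal _ , refl , p→s , s→x₀
  block-walks (block s mid f) rest p→s s→x₀ f→x₀ (a , as , amid , af) (suc (suc t)) _ (s≤s (s≤s t≤)) =
    s ∷ take t mid ++ f ∷ [] , refl ∷ ++⁺ (take-⊆ t mid) (refl ∷ []⊆-universal rest) , len ,
    p→s , walk-++ (take t mid) (clique-walk (a ∈ₑ_) common-endpoint as (All-resp-⊆ (take-⊆ t mid) amid) af) f→x₀
    where
    len : length (s ∷ take t mid ++ f ∷ []) ≡ suc (suc t)
    len = cong suc (trans (length-++ (take t mid)) (trans (+-comm _ 1) (cong suc (take-length mid t≤))))

  -- A chain provides walks from prev back to x₀ through t of its edges, for every
  -- 1 ≤ t ≤ its number of edges: whole blocks followed by a cut block.
  chain-walks : ∀ {x₀ prev} bs → Chained x₀ prev bs → ∀ t → 1 ≤ t → t ≤ length (flatten bs) →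
    ∃ λ P → P ⊆ flatten bs × length P ≡ t × Walk Shares prev P x₀
  chain-walks [] _ t 1≤t t≤0 = ⊥-elim (<-irrefl refl (≤-trans 1≤t t≤0))
  chain-walks (b ∷ bs) (p→s , s→x₀ , f→x₀ , star , chained) t 1≤t t≤ with t ≤? size b
  ... | yes t≤b = block-walks b (flatten bs) p→s s→x₀ f→x₀ star t 1≤t t≤b
  ... | no  t≰b with m≤n⇒∃[o]m+o≡n (<⇒≤ (≰⇒> t≰b))
  ...   | zero  , refl = ⊥-elim (t≰b (≤-reflexive (+-identityʳ (size b))))
  ...   | suc r , refl with chain-walks bs chained (suc r) (s≤s z≤n)
                              (+-cancelˡ-≤ (size b) _ _ (subst (size b + suc r ≤_) (length-▸ b (flatten bs)) t≤))
  ...     | P , P⊆ , |P| , w =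
    b ▸ P , ▸-⊆ b P⊆ , trans (length-▸ b P) (cong (size b +_) |P|) , block-walk b p→s star w

  chain⇒pancyclic : {_<ₒ_ : C → C → Set} {G : Graph C} (x₀ : C × C) (bs : List Block) →
    Chained x₀ x₀ bs → Unique (x₀ ∷ flatten bs) →
    All (Vertex (LineGraph _<ₒ_ G)) (x₀ ∷ flatten bs) →
    (∀ e → Vertex (LineGraph _<ₒ_ G) e → e ∈ x₀ ∷ flatten bs) →
    2 ≤ length (flatten bs) → Pancyclic (LineGraph _<ₒ_ G)
  chain⇒pancyclic {_<ₒ_} {G} x₀ bs chained unique vertices complete 2≤ =
    suc (length (flatten bs)) ,
    (x₀ ∷ flatten bs , unique , refl , λ e → mk⇔ (complete e) (All.lookup vertices)) ,
    s≤s 2≤ , cycles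
    where
    cycles : ∀ k → 3 ≤ k → k ≤ suc (length (flatten bs)) → HasCycle (LineGraph _<ₒ_ G) k
    cycles (suc t) (s≤s 2≤t) (s≤s t≤) with chain-walks bs chained t (≤-trans (s≤s z≤n) 2≤t) t≤
    ... | P , P⊆ , refl , w =
      closed-walk⇒cycle (LineGraph _<ₒ_ G) _,_ x₀ P w (Unique-resp-⊆ (refl ∷ P⊆) unique)
        (All-resp-⊆ (refl ∷ P⊆) vertices) (≤-trans (s≤s z≤n) 2≤t)

module TwoHubs
  {C : Set} {_<_ : C → C → Set} (compare : Trichotomous _≡_ _<_)
  (elements : List C) (enumerates : ∀ x → x ∈ elements) (distinct : Unique elements)
  (G : Graph C) (vertex? : U.Decidable (Vertex G)) (adj? : ∀ x y → Dec (Adj G x y))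
  (adj-sym : ∀ {x y} → Adj G x y → Adj G y x)
  (adj-simple : ∀ {x y} → Adj G x y → Vertex G x × Vertex G y × x ≢ y)
  (u u' z : C) (u<u' : u < u') (u~u' : Adj G u u')
  (hub~ : ∀ {g a} → g ≡ u ⊎ g ≡ u' → Vertex G a → a ≢ g → a ≢ z → Adj G g a)
  (hub≁z : ∀ {g} → g ≡ u ⊎ g ≡ u' → ¬ Adj G g z)
  (a₀ : C) (a₀-ordinary : Vertex G a₀ × ¬ (a₀ ≡ u ⊎ a₀ ≡ u') × a₀ ≢ z)
  where

  L : Graph (C × C)
  L = LineGraph _<_ G

  _≟_ : DecidableEquality C
  _≟_ = tri⇒dec≈ compare

  Hub : C → Set
  Hub g = g ≡ u ⊎ g ≡ u'

  hub? : U.Decidable Hub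
  hub? g = (g ≟ u) ⊎-dec (g ≟ u')

  -- Ordinary vertices are those adjacent to both hubs; each will carry one block.
  Ordinary : C → Set
  Ordinary a = Vertex G a × ¬ Hub a × a ≢ z

  ordinary? : U.Decidable Ordinary
  ordinary? a = vertex? a ×-dec ¬? (hub? a) ×-dec ¬? (a ≟ z)

  hub-adj : ∀ {g a} → Hub g → Ordinary a → Adj G g a
  hub-adj hg (va , ¬ha , a≢z) = hub~ hg va (λ { refl → ¬ha hg }) a≢z

  hub-neighbour : ∀ {g a} → Hub g → Adj G g a → ¬ Hub a → Ordinary a
  hub-neighbour hg g~a ¬ha = proj₁ (proj₂ (adj-simple g~a)) , ¬ha , λ { refl → hub≁z hg g~a }

  edge : C → C → C × C
  edge x y with compare x y
  ... | tri< _ _ _ = x , y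
  ... | tri≈ _ _ _ = x , y
  ... | tri> _ _ _ = y , x

  edge-< : ∀ {x y} → x < y → edge x y ≡ (x , y)
  edge-< {x} {y} x<y with compare x y
  ... | tri< _ _ _   = refl
  ... | tri≈ _ _ _   = refl
  ... | tri> x≮y _ _ = ⊥-elim (x≮y x<y)

  edge-> : ∀ {x y} → x < y → edge y x ≡ (x , y)
  edge-> {x} {y} x<y with compare y x
  ... | tri< y<x _ _ = ⊥-elim (tri⇒asym compare x<y y<x)
  ... | tri≈ _ y≡x _ = ⊥-elim (tri⇒irr compare (sym y≡x) x<y)
  ... | tri> _ _ _   = refl

  edge-vertex : ∀ {x y} → Adj G x y → Vertex L (edge x y)
  edge-vertex {x} {y} x~y with compare x y
  ... | tri< x<y _ _ = x<y , x~y
  ... | tri≈ _ x≡y _ = ⊥-elim (proj₂ (proj₂ (adj-simple x~y)) x≡y)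
  ... | tri> _ _ y<x = y<x , adj-sym x~y

  edge-∋₁ : ∀ {x y} → x ∈ₑ edge x y
  edge-∋₁ {x} {y} with compare x y
  ... | tri< _ _ _ = inj₁ refl
  ... | tri≈ _ _ _ = inj₁ refl
  ... | tri> _ _ _ = inj₂ refl

  edge-∋₂ : ∀ {x y} → y ∈ₑ edge x y
  edge-∋₂ {x} {y} with compare x y
  ... | tri< _ _ _ = inj₂ refl
  ... | tri≈ _ _ _ = inj₂ refl
  ... | tri> _ _ _ = inj₁ refl

  edge-endpoints : ∀ {w x y} → w ∈ₑ edge x y → w ≡ x ⊎ w ≡ y
  edge-endpoints {w} {x} {y} w∈ with compare x y
  edge-endpoints (inj₁ refl) | tri< _ _ _ = inj₁ refl
  edge-endpoints (inj₂ refl) | tri< _ _ _ = inj₂ refl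
  edge-endpoints (inj₁ refl) | tri≈ _ _ _ = inj₁ refl
  edge-endpoints (inj₂ refl) | tri≈ _ _ _ = inj₂ refl
  edge-endpoints (inj₁ refl) | tri> _ _ _ = inj₂ refl
  edge-endpoints (inj₂ refl) | tri> _ _ _ = inj₁ refl

  vertexL? : U.Decidable (Vertex L)
  vertexL? (x , y) = tri⇒dec< compare x y ×-dec adj? x y

  owner : C × C → C
  owner (x , y) with hub? x | x ≟ z
  ... | no _ | no _ = x
  ... | _    | _    = y

  owner-first : ∀ {x y} → ¬ Hub x → x ≢ z → owner (x , y) ≡ x
  owner-first {x} ¬hx x≢z with hub? x | x ≟ z
  ... | no _   | no _    = refl
  ... | yes hx | _       = ⊥-elim (¬hx hx)
  ... | no _   | yes x≡z = ⊥-elim (x≢z x≡z)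

  owner-second : ∀ {x y} → Hub x ⊎ x ≡ z → owner (x , y) ≡ y
  owner-second {x} h with hub? x | x ≟ z
  ... | yes _  | _      = refl
  ... | no _   | yes _  = refl
  owner-second (inj₁ hx)  | no ¬hx | no _   = ⊥-elim (¬hx hx)
  owner-second (inj₂ x≡z) | no _   | no x≢z = ⊥-elim (x≢z x≡z)

  owner-endpoint : ∀ e → owner e ∈ₑ e
  owner-endpoint (x , y) with hub? x | x ≟ z
  ... | no _  | no _  = inj₁ refl
  ... | yes _ | _     = inj₂ refl
  ... | no _  | yes _ = inj₂ refl

  owner-hub-edge : ∀ {g a} → Hub g → Ordinary a → owner (edge g a) ≡ a
  owner-hub-edge {g} {a} hg (_ , ¬ha , a≢z) with compare g a
  ... | tri< _ _ _ = owner-second (inj₁ hg)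
  ... | tri≈ _ _ _ = owner-second (inj₁ hg)
  ... | tri> _ _ _ = owner-first ¬ha a≢z

  HubFree : C × C → Set
  HubFree (x , y) = ¬ Hub x × ¬ Hub y

  hub-free? : U.Decidable HubFree
  hub-free? (x , y) = ¬? (hub? x) ×-dec ¬? (hub? y)

  hub-free-∌ : ∀ {g e} → HubFree e → Hub g → ¬ g ∈ₑ e
  hub-free-∌ (¬hx , _) hg (inj₁ refl) = ¬hx hg
  hub-free-∌ (_ , ¬hy) hg (inj₂ refl) = ¬hy hg

  owner-ordinary : ∀ {e} → Vertex L e → HubFree e → Ordinary (owner e)
  owner-ordinary {x , y} (_ , x~y) (¬hx , ¬hy) = by-cases (x ≟ z)
    where
    by-cases : Dec (x ≡ z) → Ordinary (owner (x , y))
    by-cases (yes x≡z) = subst Ordinary (sym (owner-second (inj₂ x≡z)))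
      (proj₁ (proj₂ (adj-simple x~y)) , ¬hy , λ y≡z → proj₂ (proj₂ (adj-simple x~y)) (trans x≡z (sym y≡z)))
    by-cases (no x≢z)  = subst Ordinary (sym (owner-first ¬hx x≢z)) (proj₁ (adj-simple x~y) , ¬hx , x≢z)

  Owned : C → C × C → Set
  Owned a e = Vertex L e × HubFree e × owner e ≡ a

  owned? : ∀ a → U.Decidable (Owned a)
  owned? a e = vertexL? e ×-dec hub-free? e ×-dec (owner e ≟ a)

  pairs : List (C × C)
  pairs = cartesianProduct elements elements

  owned : C → List (C × C)
  owned a = filter (owned? a) pairs

  owned⁺ : ∀ {a e} → Owned a e → e ∈ owned a
  owned⁺ {e = x , y} o = ∈-filter⁺ (owned? _) (∈-cartesianProduct⁺ (enumerates x) (enumerates y)) o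

  owned⁻ : ∀ {a e} → e ∈ owned a → Owned a e
  owned⁻ {a} e∈ = proj₂ (∈-filter⁻ (owned? a) {xs = pairs} e∈)

  owned-unique : ∀ a → Unique (owned a)
  owned-unique a = UP.filter⁺ (owned? a) (UP.cartesianProduct⁺ distinct distinct)

  HubPair : C → C → Set
  HubPair g g' = (g ≡ u × g' ≡ u') ⊎ (g ≡ u' × g' ≡ u)

  swap-pair : ∀ {g g'} → HubPair g g' → HubPair g' g
  swap-pair (inj₁ (p , q)) = inj₂ (q , p)
  swap-pair (inj₂ (p , q)) = inj₁ (q , p)

  pair-hub₁ : ∀ {g g'} → HubPair g g' → Hub g
  pair-hub₁ (inj₁ (p , _)) = inj₁ p
  pair-hub₁ (inj₂ (p , _)) = inj₂ p

  pair-hub₂ : ∀ {g g'} → HubPair g g' → Hub g'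
  pair-hub₂ = pair-hub₁ ∘ swap-pair

  pair-distinct : ∀ {g g'} → HubPair g g' → g ≢ g'
  pair-distinct (inj₁ (refl , refl)) u≡u' = tri⇒irr compare u≡u' u<u'
  pair-distinct (inj₂ (refl , refl)) u'≡u = tri⇒irr compare (sym u'≡u) u<u'

  pair-covers : ∀ {g g' h} → HubPair g g' → Hub h → h ≡ g ⊎ h ≡ g'
  pair-covers (inj₁ (refl , refl)) hh = hh
  pair-covers (inj₂ (refl , refl)) (inj₁ h≡u)  = inj₂ h≡u
  pair-covers (inj₂ (refl , refl)) (inj₂ h≡u') = inj₁ h≡u'

  -- The edge joining the hubs, the common meeting point of all blocks.
  x₀ : C × C
  x₀ = u , u'

  hub-∈ₑ-x₀ : ∀ {g} → Hub g → g ∈ₑ x₀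
  hub-∈ₑ-x₀ (inj₁ g≡u)  = inj₁ (sym g≡u)
  hub-∈ₑ-x₀ (inj₂ g≡u') = inj₂ (sym g≡u')

  star : C → C → C → Block
  star g a g' = block (edge g a) (owned a) (edge g' a)

  chain : C → C → List C → List Block
  chain g g' []       = []
  chain g g' (a ∷ as) = star g a g' ∷ chain g' g as

  owned-through : ∀ a → All (a ∈ₑ_) (owned a)
  owned-through a = All.tabulate λ {e} e∈ → subst (_∈ₑ e) (proj₂ (proj₂ (owned⁻ e∈))) (owner-endpoint e)

  chained : ∀ {g g'} prev as → HubPair g g' → g ∈ₑ prev → Chained x₀ prev (chain g g' as)
  chained prev []       hp g∈prev = tt
  chained prev (a ∷ as) hp g∈prev =
    common-endpoint g∈prev edge-∋₁ , common-endpoint edge-∋₁ (hub-∈ₑ-x₀ (pair-hub₁ hp)) ,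
    common-endpoint edge-∋₁ (hub-∈ₑ-x₀ (pair-hub₂ hp)) , (a , edge-∋₂ , owned-through a , edge-∋₂) ,
    chained _ as (swap-pair hp) edge-∋₁

  chain-vertices : ∀ {g g'} as → HubPair g g' → All Ordinary as → All (Vertex L) (flatten (chain g g' as))
  chain-vertices []       hp []          = []
  chain-vertices (a ∷ as) hp (oa ∷ oas) =
    edge-vertex (hub-adj (pair-hub₁ hp) oa) ∷
    AllP.++⁺ (All.tabulate (proj₁ ∘ owned⁻))
             (edge-vertex (hub-adj (pair-hub₂ hp) oa) ∷ chain-vertices as (swap-pair hp) oas)

  star-owner : ∀ {g g' a} → HubPair g g' → Ordinary a → All (λ e → owner e ≡ a) (star g a g' ▸ [])
  star-owner hp oa =
    owner-hub-edge (pair-hub₁ hp) oa ∷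
    AllP.++⁺ (All.tabulate (proj₂ ∘ proj₂ ∘ owned⁻)) (owner-hub-edge (pair-hub₂ hp) oa ∷ [])

  chain-owners : ∀ {g g'} as → HubPair g g' → All Ordinary as →
    All (λ e → owner e ∈ as) (flatten (chain g g' as))
  chain-owners []       hp []         = []
  chain-owners {g} {g'} (a ∷ as) hp (oa ∷ oas) =
    subst (All _) (sym (▸-++ (star g a g') _))
      (AllP.++⁺ (All.map here (star-owner hp oa)) (All.map there (chain-owners as (swap-pair hp) oas)))

  owned-hub-free : ∀ {a e h} → e ∈ owned a → Hub h → ¬ h ∈ₑ e
  owned-hub-free e∈ = hub-free-∌ (proj₁ (proj₂ (owned⁻ e∈)))

  -- The edges of a star are distinct: its two hub edges lie outside the hub-free
  -- owned edges, and differ since they use different hubs.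
  star-unique : ∀ {g g' a} → HubPair g g' → Ordinary a → Unique (star g a g' ▸ [])
  star-unique {g} {g'} {a} hp (_ , ¬ha , _) =
    All.tabulate first-new ∷ UP.++⁺ (owned-unique a) ([] ∷ []) last-new
    where
    first-new : ∀ {e} → e ∈ owned a ++ edge g' a ∷ [] → edge g a ≢ e
    first-new e∈ refl with ∈-++⁻ (owned a) e∈
    ... | inj₁ e∈owned = owned-hub-free e∈owned (pair-hub₁ hp) edge-∋₁
    ... | inj₂ (here e≡) with edge-endpoints (subst (g ∈ₑ_) e≡ edge-∋₁)
    ...   | inj₁ g≡g' = pair-distinct hp g≡g'
    ...   | inj₂ g≡a  = ¬ha (subst Hub g≡a (pair-hub₁ hp))
    last-new : Disjoint (owned a) (edge g' a ∷ [])
    last-new (e∈owned , here refl) = owned-hub-free e∈owned (pair-hub₂ hp) edge-∋₁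

  -- Stars of distinct vertices are disjoint, as their edges have different owners.
  chain-unique : ∀ {g g'} as → HubPair g g' → Unique as → All Ordinary as →
    Unique (flatten (chain g g' as))
  chain-unique []       hp []           []         = []
  chain-unique {g} {g'} (a ∷ as) hp (a∉as ∷ uas) (oa ∷ oas) =
    subst Unique (sym (▸-++ (star g a g') _))
      (UP.++⁺ (star-unique hp oa) (chain-unique as (swap-pair hp) uas oas) separate)
    where
    separate : Disjoint (star g a g' ▸ []) (flatten (chain g' g as))
    separate (e∈star , e∈rest) =
      All.lookup a∉as (All.lookup (chain-owners as (swap-pair hp) oas) e∈rest)
                 (sym (All.lookup (star-owner hp oa) e∈star))

  chain-hub-edge : ∀ {g g' h a} as → HubPair g g' → Hub h → a ∈ as → edge h a ∈ flatten (chain g g' as)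
  chain-hub-edge (b ∷ as) hp hh (here refl) with pair-covers hp hh
  ... | inj₁ refl = here refl
  ... | inj₂ refl = there (∈-++⁺ʳ (owned b) (here refl))
  chain-hub-edge (b ∷ as) hp hh (there a∈) =
    there (∈-++⁺ʳ (owned b) (there (chain-hub-edge as (swap-pair hp) hh a∈)))

  chain-owned : ∀ {g g' a e} as → a ∈ as → e ∈ owned a → e ∈ flatten (chain g g' as)
  chain-owned (b ∷ as) (here refl) e∈ = there (∈-++⁺ˡ e∈)
  chain-owned (b ∷ as) (there a∈) e∈ = there (∈-++⁺ʳ (owned b) (there (chain-owned as a∈ e∈)))

  chain-length : ∀ {g g' a} as → a ∈ as → 2 ≤ length (flatten (chain g g' as))
  chain-length {g} {g'} (b ∷ as) _ = subst (2 ≤_) (sym (length-▸ (star g b g') _)) (s≤s (s≤s z≤n))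

  ordinaries : List C
  ordinaries = filter ordinary? elements

  ordinary-∈ : ∀ {a} → Ordinary a → a ∈ ordinaries
  ordinary-∈ {a} oa = ∈-filter⁺ ordinary? (enumerates a) oa

  all-ordinary : All Ordinary ordinaries
  all-ordinary = AllP.all-filter ordinary? elements

  from-u : HubPair u u'
  from-u = inj₁ (refl , refl)

  stars : List Block
  stars = chain u u' ordinaries

  hubs-edge : ∀ {x y} → Hub x → Hub y → x < y → (x , y) ≡ x₀
  hubs-edge (inj₁ refl) (inj₂ refl) _    = refl
  hubs-edge (inj₁ refl) (inj₁ refl) u<u  = ⊥-elim (tri⇒irr compare refl u<u)
  hubs-edge (inj₂ refl) (inj₂ refl) u'<u' = ⊥-elim (tri⇒irr compare refl u'<u')
  hubs-edge (inj₂ refl) (inj₁ refl) u'<u = ⊥-elim (tri⇒asym compare u<u' u'<u)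

  -- Every vertex of L is listed: hub edges by chain-hub-edge, hub-free ones by owner.
  complete : ∀ e → Vertex L e → e ∈ x₀ ∷ flatten stars
  complete (x , y) (x<y , x~y) with hub? x | hub? y
  ... | yes hx | yes hy = here (hubs-edge hx hy x<y)
  ... | yes hx | no ¬hy = there (subst (_∈ _) (edge-< x<y)
                            (chain-hub-edge ordinaries from-u hx (ordinary-∈ (hub-neighbour hx x~y ¬hy))))
  ... | no ¬hx | yes hy = there (subst (_∈ _) (edge-> x<y)
                            (chain-hub-edge ordinaries from-u hy (ordinary-∈ (hub-neighbour hy (adj-sym x~y) ¬hx))))
  ... | no ¬hx | no ¬hy = there (chain-owned ordinaries (ordinary-∈ (owner-ordinary (x<y , x~y) (¬hx , ¬hy)))
                                   (owned⁺ ((x<y , x~y) , (¬hx , ¬hy) , refl)))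

  -- x₀ is not in the chain: it would belong to the hub u'.
  x₀-new : All (x₀ ≢_) (flatten stars)
  x₀-new = All.tabulate λ { e∈ refl →
    proj₁ (proj₂ (All.lookup all-ordinary
      (subst (_∈ ordinaries) (owner-second (inj₁ (inj₁ refl)))
        (All.lookup (chain-owners ordinaries from-u all-ordinary) e∈)))) (inj₂ refl) }

  pancyclic : Pancyclic L
  pancyclic =
    chain⇒pancyclic {G = G} x₀ stars (chained x₀ ordinaries from-u (inj₁ refl))
      (x₀-new ∷ chain-unique ordinaries from-u (UP.filter⁺ ordinary? distinct) all-ordinary)
      ((u<u' , u~u') ∷ chain-vertices ordinaries from-u all-ordinary)
      complete
      (chain-length ordinaries (ordinary-∈ a₀-ordinary))

module _ (n : ℕ) .{{_ : NonZero n}} where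

  toℕ-mod : ∀ {x} → x < n → toℕ (x mod n) ≡ x
  toℕ-mod x<n = trans (toℕ-fromℕ< _) (m<n⇒m%n≡m x<n)

  elementsᵢ : List (ZnI n)
  elementsᵢ = cartesianProduct (allFin n) (allFin n)

  elementsᵢ-complete : ∀ x → x ∈ elementsᵢ
  elementsᵢ-complete (a , b) = ∈-cartesianProduct⁺ (∈-allFin a) (∈-allFin b)

  elementsᵢ-unique : Unique elementsᵢ
  elementsᵢ-unique = UP.cartesianProduct⁺ (UP.allFin⁺ n) (UP.allFin⁺ n)

  _≟ᵢ_ : DecidableEquality (ZnI n)
  _≟ᵢ_ = ≡-dec F._≟_ F._≟_

  key : ZnI n → ℕ
  key (a , b) = toℕ a * n + toℕ b

  key-injective : ∀ x y → key x ≡ key y → x ≡ y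
  key-injective (a , b) (c , d) eq = cong₂ _,_ (toℕ-injective a≡c) (toℕ-injective b≡d)
    where
    key%n : ∀ (a b : Fin n) → key (a , b) % n ≡ toℕ b
    key%n a b = trans (cong (_% n) (+-comm (toℕ a * n) (toℕ b)))
                      (trans ([m+kn]%n≡m%n (toℕ b) (toℕ a) n) (m<n⇒m%n≡m (toℕ<n b)))
    b≡d : toℕ b ≡ toℕ d
    b≡d = trans (sym (key%n a b)) (trans (cong (_% n) eq) (key%n c d))
    a≡c : toℕ a ≡ toℕ c
    a≡c = *-cancelʳ-≡ (toℕ a) (toℕ c) n (+-cancelʳ-≡ (toℕ b) _ _ (trans eq (cong (toℕ c * n +_) (sym b≡d))))

  compareᵢ : Trichotomous _≡_ (_<ᵢ_ {n})
  compareᵢ x y with <-cmp (key x) (key y)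
  ... | tri< lt ¬eq ¬gt = tri< lt (¬eq ∘ cong key) ¬gt
  ... | tri≈ ¬lt eq ¬gt = tri≈ ¬lt (key-injective x y eq) ¬gt
  ... | tri> ¬lt ¬eq gt = tri> ¬lt (¬eq ∘ cong key) gt

  mulᵢ-comm : ∀ x y → mulᵢ n x y ≡ mulᵢ n y x
  mulᵢ-comm (a , b) (c , d) = cong₂ _,_
    (cong (_mod n) (cong₂ _+_ (*-comm (toℕ a) (toℕ c)) (cong ((n ∸ 1) *_) (*-comm (toℕ b) (toℕ d)))))
    (cong (_mod n) (trans (+-comm (toℕ a * toℕ d) (toℕ b * toℕ c))
                          (cong₂ _+_ (*-comm (toℕ b) (toℕ c)) (*-comm (toℕ a) (toℕ d)))))

  zero-divisor? : U.Decidable (IsNZZeroDivisor n)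
  zero-divisor? x = ¬? (x ≟ᵢ 0ᵢ n) ×-dec
    map′ (λ (a , b , p) → (a , b) , p) (λ ((a , b) , p) → a , b , p)
         (any? λ a → any? λ b → ¬? ((a , b) ≟ᵢ 0ᵢ n) ×-dec (mulᵢ n x (a , b) ≟ᵢ 0ᵢ n))

  complement-adj? : ∀ x y → Dec (Adj (complement (Γ n)) x y)
  complement-adj? x y = zero-divisor? x ×-dec zero-divisor? y ×-dec ¬? (x ≟ᵢ y) ×-dec
                        ¬? (¬? (x ≟ᵢ y) ×-dec (mulᵢ n x y ≟ᵢ 0ᵢ n))

  complement-sym : ∀ {x y} → Adj (complement (Γ n)) x y → Adj (complement (Γ n)) y x
  complement-sym {x} {y} (vx , vy , x≢y , x≁y) =
    vy , vx , x≢y ∘ sym , λ (y≢x , yx≡0) → x≁y (x≢y , trans (mulᵢ-comm x y) yx≡0)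

module EvenModulus (k : ℕ) (1≤k : 1 ≤ k) where

  h n p : ℕ
  h = suc k
  n = h + h
  -- p = n - 1 represents -1; it is the constant  n ∸ 1  used by mulᵢ.
  p = k + suc k

  1<h : 1 < h
  1<h = s≤s 1≤k

  1<p : 1 < p
  1<p = ≤-trans 1<h (m≤n+m h k)

  h<n : h < n
  h<n = m<m+n h (s≤s z≤n)

  p<n : p < n
  p<n = n<1+n p

  2<n : 2 < n
  2<n = s≤s (+-mono-≤ 1≤k (s≤s z≤n))

  1<n : 1 < n
  1<n = <⇒≤ 2<n

  0<n : 0 < n
  0<n = s≤s z≤n

  -- Modulo n, x + p·y is x - y: for residues it vanishes only when x = y.
  residue-cancel : ∀ {x y} → x < n → y < n → n ∣ x + p * y → x ≡ y
  residue-cancel {x} {y} x<n y<n (divides q x+py≡qn) = begin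
    x                ≡⟨ m<n⇒m%n≡m x<n ⟨
    x % n            ≡⟨ [m+kn]%n≡m%n x y n ⟨
    (x + y * n) % n  ≡⟨ cong (_% n) shift ⟩
    (y + q * n) % n  ≡⟨ [m+kn]%n≡m%n y q n ⟩
    y % n            ≡⟨ m<n⇒m%n≡m y<n ⟩
    y                ∎
    where
    identity : ∀ x y k → x + y * (suc k + suc k) ≡ (x + (k + suc k) * y) + y
    identity = solve-∀
    shift : x + y * n ≡ y + q * n
    shift = trans (identity x y k) (trans (cong (_+ y) x+py≡qn) (+-comm (q * n) y))

  double-injective : ∀ {x y} → x + x ≡ y + y → x ≡ y
  double-injective {x} {y} eq with <-cmp x y
  ... | tri< x<y _ _ = ⊥-elim (<-irrefl eq (+-mono-< x<y x<y))
  ... | tri≈ _ x≡y _ = x≡y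
  ... | tri> _ _ y<x = ⊥-elim (<-irrefl (sym eq) (+-mono-< y<x y<x))

  halves : ∀ {x} → x < n → n ∣ x + x → x ≡ 0 ⊎ x ≡ h
  halves {x} x<n (divides zero          2x≡0)  = inj₁ (m+n≡0⇒m≡0 x 2x≡0)
  halves {x} x<n (divides (suc zero)    2x≡n)  = inj₂ (double-injective (trans 2x≡n (+-identityʳ n)))
  halves {x} x<n (divides (suc (suc q)) 2x≡qn) =
    ⊥-elim (<-irrefl 2x≡qn (≤-trans (+-mono-< x<n x<n) (+-monoʳ-≤ n (m≤m+n n (q * n)))))

  diagonal : ∀ {c} → c < n → n ∣ c + c → (c ≡ 0 × c ≡ 0) ⊎ (c ≡ h × c ≡ h)
  diagonal c<n n∣2c with halves c<n n∣2c
  ... | inj₁ c≡0 = inj₁ (c≡0 , c≡0)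
  ... | inj₂ c≡h = inj₂ (c≡h , c≡h)

  -- Since p² + 1 = 2 + 2k·n,  c + p²c ≡ 2c  (mod n).
  p²+1 : ∀ c → n ∣ c + p * (p * c) → n ∣ c + c
  p²+1 c n∣c+p²c = ∣m+n∣m⇒∣n (subst (n ∣_) (trans (identity c k) (+-comm (c + c) _)) n∣c+p²c)
                             (n∣m*n ((k + k) * c))
    where
    identity : ∀ c k → c + (k + suc k) * ((k + suc k) * c) ≡ (c + c) + ((k + k) * c) * (suc k + suc k)
    identity = solve-∀

  -- The coordinates (c , d) of an annihilator of 1 + i satisfy  c - d ≡ 0  and  c + d ≡ 0.
  annihilator-1+i : ∀ {c d} → c < n → d < n → n ∣ c + p * d → n ∣ d + c →
    (c ≡ 0 × d ≡ 0) ⊎ (c ≡ h × d ≡ h)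
  annihilator-1+i c<n d<n n∣c-d n∣d+c with residue-cancel c<n d<n n∣c-d
  ... | refl = diagonal c<n n∣d+c

  -- The coordinates (c , d) of an annihilator of 1 - i satisfy  c + p²d ≡ 0  and  d - c ≡ 0.
  annihilator-1-i : ∀ {c d} → c < n → d < n → n ∣ c + p * (p * d) → n ∣ d + p * c →
    (c ≡ 0 × d ≡ 0) ⊎ (c ≡ h × d ≡ h)
  annihilator-1-i {c} c<n d<n n∣c+p²d n∣d-c with residue-cancel d<n c<n n∣d-c
  ... | refl = diagonal c<n (p²+1 c n∣c+p²d)

  ⟨_,_⟩ : ℕ → ℕ → ZnI n
  ⟨ a , b ⟩ = a mod n , b mod n

  coordinates : ∀ y → y ≡ ⟨ toℕ (proj₁ y) , toℕ (proj₂ y) ⟩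
  coordinates (c , d) = cong₂ _,_ (toℕ-injective (sym (toℕ-mod n (toℕ<n c))))
                                  (toℕ-injective (sym (toℕ-mod n (toℕ<n d))))

  mul-⟨⟩ : ∀ {a b c d} → a < n → b < n → c < n → d < n →
    mulᵢ n ⟨ a , b ⟩ ⟨ c , d ⟩ ≡ ⟨ a * c + p * (b * d) , a * d + b * c ⟩
  mul-⟨⟩ a<n b<n c<n d<n rewrite toℕ-mod n a<n | toℕ-mod n b<n | toℕ-mod n c<n | toℕ-mod n d<n = refl

  ⟨⟩≡0⇒∣ : ∀ {A B} → ⟨ A , B ⟩ ≡ 0ᵢ n → n ∣ A × n ∣ B
  ⟨⟩≡0⇒∣ {A} {B} eq = m%n≡0⇒n∣m A n (trans (sym (toℕ-fromℕ< _)) (cong (toℕ ∘ proj₁) eq))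
                     , m%n≡0⇒n∣m B n (trans (sym (toℕ-fromℕ< _)) (cong (toℕ ∘ proj₂) eq))

  ∣⇒⟨⟩≡0 : ∀ {A B} → n ∣ A → n ∣ B → ⟨ A , B ⟩ ≡ 0ᵢ n
  ∣⇒⟨⟩≡0 {A} {B} n∣A n∣B = cong₂ _,_ (toℕ-injective (trans (toℕ-fromℕ< _) (n∣m⇒m%n≡0 A n n∣A)))
                                      (toℕ-injective (trans (toℕ-fromℕ< _) (n∣m⇒m%n≡0 B n n∣B)))

  re-≢ : ∀ {a c} → a < n → c < n → a ≢ c → ∀ b d → ⟨ a , b ⟩ ≢ ⟨ c , d ⟩
  re-≢ a<n c<n a≢c b d eq = a≢c (trans (sym (toℕ-mod n a<n)) (trans (cong (toℕ ∘ proj₁) eq) (toℕ-mod n c<n)))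

  im-≢ : ∀ {b d} → b < n → d < n → b ≢ d → ∀ a c → ⟨ a , b ⟩ ≢ ⟨ c , d ⟩
  im-≢ b<n d<n b≢d a c eq = b≢d (trans (sym (toℕ-mod n b<n)) (trans (cong (toℕ ∘ proj₂) eq) (toℕ-mod n d<n)))

  product-coordinates : ∀ {a b} → a < n → b < n → ∀ y → mulᵢ n ⟨ a , b ⟩ y ≡ 0ᵢ n →
    let c = toℕ (proj₁ y) ; d = toℕ (proj₂ y) in n ∣ a * c + p * (b * d) × n ∣ a * d + b * c
  product-coordinates {a} {b} a<n b<n y ay≡0 =
    ⟨⟩≡0⇒∣ (trans (sym (mul-⟨⟩ a<n b<n (toℕ<n (proj₁ y)) (toℕ<n (proj₂ y))))
                  (trans (cong (mulᵢ n ⟨ a , b ⟩) (sym (coordinates y))) ay≡0))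

  zero-or-z : ∀ y → let c = toℕ (proj₁ y) ; d = toℕ (proj₂ y) in
    (c ≡ 0 × d ≡ 0) ⊎ (c ≡ h × d ≡ h) → y ≡ 0ᵢ n ⊎ y ≡ ⟨ h , h ⟩
  zero-or-z y (inj₁ (c≡0 , d≡0)) = inj₁ (trans (coordinates y) (cong₂ ⟨_,_⟩ c≡0 d≡0))
  zero-or-z y (inj₂ (c≡h , d≡h)) = inj₂ (trans (coordinates y) (cong₂ ⟨_,_⟩ c≡h d≡h))

  one+i one-i z two : ZnI n
  one+i = ⟨ 1 , 1 ⟩
  one-i = ⟨ 1 , p ⟩
  z     = ⟨ h , h ⟩
  two   = ⟨ 2 , 0 ⟩

  annihilator-one+i : ∀ y → mulᵢ n one+i y ≡ 0ᵢ n → y ≡ 0ᵢ n ⊎ y ≡ z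
  annihilator-one+i y e with product-coordinates 1<n 1<n y e
  ... | n∣re , n∣im = zero-or-z y (annihilator-1+i (toℕ<n c) (toℕ<n d)
    (subst (n ∣_) (cong₂ (λ a b → a + p * b) (*-identityˡ (toℕ c)) (*-identityˡ (toℕ d))) n∣re)
    (subst (n ∣_) (cong₂ _+_ (*-identityˡ (toℕ d)) (*-identityˡ (toℕ c))) n∣im))
    where
    c d : Fin n
    c = proj₁ y
    d = proj₂ y

  annihilator-one-i : ∀ y → mulᵢ n one-i y ≡ 0ᵢ n → y ≡ 0ᵢ n ⊎ y ≡ z
  annihilator-one-i y e with product-coordinates 1<n p<n y e
  ... | n∣re , n∣im = zero-or-z y (annihilator-1-i (toℕ<n c) (toℕ<n d)
    (subst (n ∣_) (cong (_+ p * (p * toℕ d)) (*-identityˡ (toℕ c))) n∣re)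
    (subst (n ∣_) (cong (_+ p * toℕ c) (*-identityˡ (toℕ d))) n∣im))
    where
    c d : Fin n
    c = proj₁ y
    d = proj₂ y

  one+i·z : mulᵢ n one+i z ≡ 0ᵢ n
  one+i·z = trans (mul-⟨⟩ 1<n 1<n h<n h<n) (∣⇒⟨⟩≡0 (divides h (re k)) (divides 1 (im k)))
    where
    re : ∀ k → 1 * suc k + (k + suc k) * (1 * suc k) ≡ suc k * (suc k + suc k)
    re = solve-∀
    im : ∀ k → 1 * suc k + 1 * suc k ≡ 1 * (suc k + suc k)
    im = solve-∀

  one-i·z : mulᵢ n one-i z ≡ 0ᵢ n
  one-i·z = trans (mul-⟨⟩ 1<n p<n h<n h<n) (∣⇒⟨⟩≡0 (divides (suc k * (k + k) + 1) (re k)) (divides h (im k)))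
    where
    re : ∀ k → 1 * suc k + (k + suc k) * ((k + suc k) * suc k) ≡ (suc k * (k + k) + 1) * (suc k + suc k)
    re = solve-∀
    im : ∀ k → 1 * suc k + (k + suc k) * suc k ≡ suc k * (suc k + suc k)
    im = solve-∀

  two·z : mulᵢ n two z ≡ 0ᵢ n
  two·z = trans (mul-⟨⟩ 2<n 0<n h<n h<n) (∣⇒⟨⟩≡0 (divides 1 (re k)) (divides 1 (im k)))
    where
    re : ∀ k → 2 * suc k + (k + suc k) * (0 * suc k) ≡ 1 * (suc k + suc k)
    re = solve-∀
    im : ∀ k → 2 * suc k + 0 * suc k ≡ 1 * (suc k + suc k)
    im = solve-∀

  G : Graph (ZnI n)
  G = complement (Γ n)

  Hub : ZnI n → Set
  Hub g = g ≡ one+i ⊎ g ≡ one-i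

  hub-annihilator : ∀ {g y} → Hub g → mulᵢ n g y ≡ 0ᵢ n → y ≡ 0ᵢ n ⊎ y ≡ z
  hub-annihilator (inj₁ refl) = annihilator-one+i _
  hub-annihilator (inj₂ refl) = annihilator-one-i _

  hub·z : ∀ {g} → Hub g → mulᵢ n g z ≡ 0ᵢ n
  hub·z (inj₁ refl) = one+i·z
  hub·z (inj₂ refl) = one-i·z

  z≢0 : z ≢ 0ᵢ n
  z≢0 = re-≢ h<n 0<n (λ ()) h 0

  hub-vertex : ∀ {g} → Hub g → IsNZZeroDivisor n g
  hub-vertex (inj₁ refl) = re-≢ 1<n 0<n (λ ()) 1 0 , z , z≢0 , one+i·z
  hub-vertex (inj₂ refl) = re-≢ 1<n 0<n (λ ()) p 0 , z , z≢0 , one-i·z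

  hub~ : ∀ {g a} → Hub g → Vertex G a → a ≢ g → a ≢ z → Adj G g a
  hub~ hg va a≢g a≢z = hub-vertex hg , va , (λ g≡a → a≢g (sym g≡a)) ,
    λ (_ , ga≡0) → [ proj₁ va , a≢z ]′ (hub-annihilator hg ga≡0)

  hub≁z : ∀ {g} → Hub g → ¬ Adj G g z
  hub≁z hg (_ , _ , g≢z , g≁z) = g≁z (g≢z , hub·z hg)

  one+i<one-i : one+i <ᵢ one-i
  one+i<one-i rewrite toℕ-mod n 1<n | toℕ-mod n p<n = +-monoʳ-< (1 * n) 1<p

  one+i~one-i : Adj G one+i one-i
  one+i~one-i = hub~ (inj₁ refl) (hub-vertex (inj₂ refl))
    (im-≢ p<n 1<n (λ p≡1 → <-irrefl (sym p≡1) 1<p) 1 1) (re-≢ 1<n h<n (λ 1≡h → <-irrefl 1≡h 1<h) p h)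

  two-ordinary : Vertex G two × ¬ Hub two × two ≢ z
  two-ordinary = (re-≢ 2<n 0<n (λ ()) 0 0 , z , z≢0 , two·z) ,
                 [ re-≢ 2<n 1<n (λ ()) 0 1 , re-≢ 2<n 1<n (λ ()) 0 p ]′ , im-≢ 0<n h<n (λ ()) 2 h

  pancyclic : Pancyclic (LineGraph _<ᵢ_ G)
  pancyclic = TwoHubs.pancyclic (compareᵢ n) (elementsᵢ n) (elementsᵢ-complete n) (elementsᵢ-unique n)
    G (zero-divisor? n) (complement-adj? n) (complement-sym n) (λ (vx , vy , x≢y , _) → vx , vy , x≢y)
    one+i one-i z one+i<one-i one+i~one-i hub~ hub≁z two two-ordinary

same-modulus : ∀ {n₁ n₂} → n₁ ≡ n₂ → .{{_ : NonZero n₁}} .{{_ : NonZero n₂}} →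
  Pancyclic (LineGraph _<ᵢ_ (complement (Γ n₁))) → Pancyclic (LineGraph _<ᵢ_ (complement (Γ n₂)))
same-modulus refl P = P

power-of-two-halves : ∀ m → 2 ≤ m → ∃ λ k → 1 ≤ k × 2 ^ m ≡ suc k + suc k
power-of-two-halves (suc zero) (s≤s ())
power-of-two-halves (suc (suc j)) _ = x ∸ 1 , ∸-monoˡ-≤ 1 2≤x , 2^m≡
  where
  x : ℕ
  x = 2 ^ suc j
  2≤x : 2 ≤ x
  2≤x = +-mono-≤ (m^n>0 2 j) (≤-trans (m^n>0 2 j) (m≤m+n _ 0))
  2^m≡ : 2 ^ suc (suc j) ≡ suc (x ∸ 1) + suc (x ∸ 1)
  2^m≡ = trans (cong (x +_) (+-identityʳ x)) (sym (cong₂ _+_ suc[x-1] suc[x-1]))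
    where
    suc[x-1] : 1 + (x ∸ 1) ≡ x
    suc[x-1] = m+[n∸m]≡n (≤-trans (s≤s z≤n) 2≤x)

theorem5p1 : (m : ℕ) → 2 ≤ m →
    Pancyclic (LineGraph _<ᵢ_ (complement (Γ (2 ^ m) {{m^n≢0 2 m}})))
theorem5p1 m 2≤m with power-of-two-halves m 2≤m
... | k , 1≤k , 2^m≡2[k+1] =
  same-modulus (sym 2^m≡2[k+1]) {{_}} {{m^n≢0 2 m}} (EvenModulus.pancyclic k 1≤k)
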